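{- Let $B_\infty$ be the infinite braid group, with generators $\sigma_i$ ($i\ge 1$) subject to $\sigma_i\sigma_j=\sigma_j\sigma_i$ when $|i-j|>1$ and $\sigma_i\sigma_j\sigma_i=\sigma_j\sigma_i\sigma_j$ when $|i-j|=1$. Let ${\cal F}_G$ be the free group on generators $g_0,g_1,g_2,\ldots$, and let $B_\infty$ act on ${\cal F}_G$ on the right by automorphisms via $(g_i)\sigma_i=g_i g_{i+1} g_i^{ -1}$, $(g_{i+1})\sigma_i=g_i$, and $(g_j)\sigma_i=g_j$ for $j\ne i,i+1$. If a reduced word $f\in{\cal F}_G$ begins with $g_1$, and $\sigma\in B_\infty$ is a generator $\sigma_i$ or the inverse $\sigma_i^{ -1}$ of a generator, but $\sigma\neq\sigma_1^{ -1}$, then the reduced form of $(f)\sigma$ also begins with $g_1$.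
   Context: The displayed assignments on generators extend to a well-defined right action of $B_\infty$ on ${\cal F}_G$ by group automorphisms; $(f)p$ denotes the image of $f$ under $p$, and $(f)(pq)=((f)p)q$. Consequently $(g_i)\sigma_i^{ -1}=g_{i+1}$, $(g_{i+1})\sigma_i^{ -1}=g_{i+1}^{ -1}g_i g_{i+1}$, $(g_j)\sigma_i^{ -1}=g_j$ for $j\ne i,i+1$. "Reduced word" means freely reduced word in the generators $g_j$ and their inverses; "begins with" refers to its first letter. -}

module Defs where

open import Data.Nat using (ℕ; zero; suc; _≡ᵇ_)
open import Data.Bool using (Bool; true; false; not; if_then_else_)
open import Data.Product using (_×_; _,_; ∃)
open import Data.List using (List; []; _∷_; reverse; map; concatMap; foldr)
open import Relation.Nullary using (¬_)
open import Relation.Binary.PropositionalEquality using (_≡_)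
open import Data.Unit using (⊤)

-- Elements of the free group F_G on g_0, g_1, g_2, ... are represented by
-- words; the letter (j , true) is g_j and (j , false) is g_j⁻¹.
Letter : Set
Letter = ℕ × Bool

Word : Set
Word = List Letter

g : ℕ → Letter
g j = j , true

g⁻¹ : ℕ → Letter
g⁻¹ j = j , false

invL : Letter → Letter
invL (j , b) = j , not b

invW : Word → Word
invW w = reverse (map invL w)

IsReduced : Word → Set
IsReduced [] = ⊤
IsReduced (x ∷ []) = ⊤
IsReduced (x ∷ y ∷ w) = ¬ (y ≡ invL x) × IsReduced (y ∷ w)

_≡L_ : Letter → Letter → Bool
(i , true) ≡L (j , true) = i ≡ᵇ j
(i , false) ≡L (j , false) = i ≡ᵇ j
(i , true) ≡L (j , false) = false
(i , false) ≡L (j , true) = false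

push : Letter → Word → Word
push x [] = x ∷ []
push x (y ∷ w) = if y ≡L invL x then w else (x ∷ y ∷ w)

reduce : Word → Word
reduce = foldr push []

actGen : ℕ → Bool → ℕ → Word
actGen i true j =
  if j ≡ᵇ i then g i ∷ g (suc i) ∷ g⁻¹ i ∷ []
  else if j ≡ᵇ suc i then g i ∷ []
  else g j ∷ []
actGen i false j =
  if j ≡ᵇ i then g (suc i) ∷ []
  else if j ≡ᵇ suc i then g⁻¹ (suc i) ∷ g i ∷ g (suc i) ∷ []
  else g j ∷ []

actLetter : ℕ → Bool → Letter → Word
actLetter i b (j , true) = actGen i b j
actLetter i b (j , false) = invW (actGen i b j)

act : ℕ → Bool → Word → Word
act i b f = reduce (concatMap (actLetter i b) f)

BeginsWithG1 : Word → Set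
BeginsWithG1 w = ∃ λ w' → w ≡ g 1 ∷ w'

-- Reading a reduced word w from the right, the first letters of the reduced form of (w)σ_i
-- depend only on the first letter of w: an initial g_i^{±1} turns into g_i g_{i+1}^{±1}, and
-- an initial g_j^{±1} with j ∉ {i, i+1} survives unchanged.  Conjugating by the letter
-- permutation κ : g_i ↦ g_{i+1}⁻¹, g_{i+1} ↦ g_i⁻¹, g_j ↦ g_j⁻¹ turns σ_i into σ_i⁻¹ and
-- fixes g_1^{±1} whenever i ≥ 2, so an initial g_1 survives every σ_i^{±1} except σ_1⁻¹.

module Submission where

open import Defs
open import Data.Nat using (ℕ; suc; _≤_; s≤s; _≡ᵇ_)
open import Data.Nat.Properties using (_≟_; ≡ᵇ⇒≡; ≡⇒≡ᵇ)
open import Data.Bool using (Bool; true; false; not; T; if_then_else_)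
open import Data.Bool.Properties as Bool using (not-involutive)
open import Data.Product using (_×_; _,_; proj₁; proj₂; ∃)
open import Data.Product.Properties using (≡-dec)
open import Data.Sum using (_⊎_; inj₁; inj₂)
open import Data.List using ([]; _∷_; map; foldr; concatMap)
open import Data.List.Properties using (foldr-++; concatMap-cong; concatMap-map; map-concatMap)
open import Data.Empty using (⊥-elim)
open import Data.Unit using (⊤; tt)
open import Function using (_∘_)
open import Relation.Nullary using (¬_; Dec; yes; no)
open import Relation.Binary.PropositionalEquality

if-≡ᵇ-refl : ∀ {A : Set} j {x y : A} → (if j ≡ᵇ j then x else y) ≡ x
if-≡ᵇ-refl j with j ≡ᵇ j | ≡⇒≡ᵇ j j refl
... | true | _ = refl

if-≡ᵇ-no : ∀ {A : Set} j k {x y : A} → j ≢ k → (if j ≡ᵇ k then x else y) ≡ y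
if-≡ᵇ-no j k j≢k with j ≡ᵇ k | ≡ᵇ⇒≡ j k
... | false | _ = refl
... | true | sound = ⊥-elim (j≢k (sound _))

≡L-refl : ∀ x → T (x ≡L x)
≡L-refl (j , true) = ≡⇒≡ᵇ j j refl
≡L-refl (j , false) = ≡⇒≡ᵇ j j refl

≡L⇒≡ : ∀ x y → T (x ≡L y) → x ≡ y
≡L⇒≡ (j , true) (k , true) p = cong (_, true) (≡ᵇ⇒≡ j k p)
≡L⇒≡ (j , false) (k , false) p = cong (_, false) (≡ᵇ⇒≡ j k p)

_≟L_ : (x y : Letter) → Dec (x ≡ y)
_≟L_ = ≡-dec _≟_ Bool._≟_

OnHead : (Letter → Set) → Word → Set
OnHead P [] = ⊤
OnHead P (y ∷ _) = P y

OnHead-map : ∀ {P Q : Letter → Set} → (∀ {y} → P y → Q y) → ∀ r → OnHead P r → OnHead Q r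
OnHead-map f [] _ = tt
OnHead-map f (y ∷ _) p = f p

≢-index : ∀ {j k : ℕ} {s t : Bool} → j ≢ k → (j , s) ≢ (k , t)
≢-index j≢k e = j≢k (cong proj₁ e)

i≢1+i : ∀ {i} → i ≢ suc i
i≢1+i ()

push-cancel : ∀ x r → push x (invL x ∷ r) ≡ r
push-cancel x r with invL x ≡L invL x | ≡L-refl (invL x)
... | true | _ = refl

push-keep : ∀ x r → OnHead (_≢ invL x) r → push x r ≡ x ∷ r
push-keep x [] _ = refl
push-keep x (y ∷ r) y≢x⁻¹ with y ≡L invL x | ≡L⇒≡ y (invL x)
... | false | _ = refl
... | true | sound = ⊥-elim (y≢x⁻¹ (sound _))

reduced-tail : ∀ x w → IsReduced (x ∷ w) → IsReduced w
reduced-tail x [] _ = tt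
reduced-tail x (y ∷ w) (_ , red) = red

act-∷ : ∀ i b x w → act i b (x ∷ w) ≡ foldr push (act i b w) (actLetter i b x)
act-∷ i b x w = foldr-++ push [] (actLetter i b x) (concatMap (actLetter i b) w)

module LetterPermutation (f : Letter → Letter)
    (f-invL : ∀ x → f (invL x) ≡ invL (f x))
    (f-injective : ∀ {x y} → f x ≡ f y → x ≡ y) where

  push-map : ∀ x w → push (f x) (map f w) ≡ map f (push x w)
  push-map x [] = refl
  push-map x (y ∷ w) with y ≟L invL x
  ... | yes refl = begin
    push (f x) (f (invL x) ∷ map f w)  ≡⟨ cong (λ z → push (f x) (z ∷ map f w)) (f-invL x) ⟩
    push (f x) (invL (f x) ∷ map f w)  ≡⟨ push-cancel (f x) (map f w) ⟩
    map f w                            ≡⟨ cong (map f) (push-cancel x w) ⟨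
    map f (push x (invL x ∷ w))        ∎
    where open ≡-Reasoning
  ... | no y≢x⁻¹ = begin
    push (f x) (f y ∷ map f w)  ≡⟨ push-keep (f x) _ (λ e → y≢x⁻¹ (f-injective (trans e (sym (f-invL x))))) ⟩
    f x ∷ f y ∷ map f w         ≡⟨ cong (map f) (push-keep x (y ∷ w) y≢x⁻¹) ⟨
    map f (push x (y ∷ w))      ∎
    where open ≡-Reasoning

  reduce-map : ∀ w → reduce (map f w) ≡ map f (reduce w)
  reduce-map [] = refl
  reduce-map (x ∷ w) = trans (cong (push (f x)) (reduce-map w)) (push-map x (reduce w))

  map-reduced : ∀ w → IsReduced w → IsReduced (map f w)
  map-reduced [] _ = tt
  map-reduced (x ∷ []) _ = tt
  map-reduced (x ∷ y ∷ w) (y≢x⁻¹ , red) =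
    (λ e → y≢x⁻¹ (f-injective (trans e (sym (f-invL x))))) , map-reduced (y ∷ w) red

σ-gᵢ : ∀ i → actGen i true i ≡ g i ∷ g (suc i) ∷ g⁻¹ i ∷ []
σ-gᵢ i = if-≡ᵇ-refl i

σ-gᵢ₊₁ : ∀ i → actGen i true (suc i) ≡ g i ∷ []
σ-gᵢ₊₁ i = trans (if-≡ᵇ-no (suc i) i (i≢1+i ∘ sym)) (if-≡ᵇ-refl i)

σ⁻¹-gᵢ : ∀ i → actGen i false i ≡ g (suc i) ∷ []
σ⁻¹-gᵢ i = if-≡ᵇ-refl i

σ⁻¹-gᵢ₊₁ : ∀ i → actGen i false (suc i) ≡ g⁻¹ (suc i) ∷ g i ∷ g (suc i) ∷ []
σ⁻¹-gᵢ₊₁ i = trans (if-≡ᵇ-no (suc i) i (i≢1+i ∘ sym)) (if-≡ᵇ-refl i)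

actGen-gⱼ : ∀ i b j → j ≢ i → j ≢ suc i → actGen i b j ≡ g j ∷ []
actGen-gⱼ i true j j≢i j≢1+i = trans (if-≡ᵇ-no j i j≢i) (if-≡ᵇ-no j (suc i) j≢1+i)
actGen-gⱼ i false j j≢i j≢1+i = trans (if-≡ᵇ-no j i j≢i) (if-≡ᵇ-no j (suc i) j≢1+i)

transpose : ℕ → ℕ → ℕ
transpose i j = if j ≡ᵇ i then suc i else if j ≡ᵇ suc i then i else j

transpose-i : ∀ i → transpose i i ≡ suc i
transpose-i i = if-≡ᵇ-refl i

transpose-1+i : ∀ i → transpose i (suc i) ≡ i
transpose-1+i i = trans (if-≡ᵇ-no (suc i) i (i≢1+i ∘ sym)) (if-≡ᵇ-refl i)

transpose-j : ∀ i j → j ≢ i → j ≢ suc i → transpose i j ≡ j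
transpose-j i j j≢i j≢1+i = trans (if-≡ᵇ-no j i j≢i) (if-≡ᵇ-no j (suc i) j≢1+i)

transpose-involutive : ∀ i j → transpose i (transpose i j) ≡ j
transpose-involutive i j with j ≟ i | j ≟ suc i
... | yes refl | _ = trans (cong (transpose j) (transpose-i j)) (transpose-1+i j)
... | no _ | yes refl = trans (cong (transpose i) (transpose-1+i i)) (transpose-i i)
... | no j≢i | no j≢1+i =
  trans (cong (transpose i) (transpose-j i j j≢i j≢1+i)) (transpose-j i j j≢i j≢1+i)

κ : ℕ → Letter → Letter
κ i (j , s) = transpose i j , not s

κ-involutive : ∀ i x → κ i (κ i x) ≡ x
κ-involutive i (j , s) = cong₂ _,_ (transpose-involutive i j) (not-involutive s)

κ-injective : ∀ i {x y} → κ i x ≡ κ i y → x ≡ y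
κ-injective i {x} {y} e = trans (sym (κ-involutive i x)) (trans (cong (κ i) e) (κ-involutive i y))

κ-conjugates-σ : ∀ i x → actLetter i false x ≡ map (κ i) (actLetter i true (κ i x))
κ-conjugates-σ i (j , s) with j ≟ i | j ≟ suc i | s
... | yes refl | _ | true rewrite transpose-i j | σ-gᵢ₊₁ j | σ⁻¹-gᵢ j =
  cong (λ k → (k , true) ∷ []) (sym (transpose-i j))
... | yes refl | _ | false rewrite transpose-i j | σ-gᵢ₊₁ j | σ⁻¹-gᵢ j =
  cong (λ k → (k , false) ∷ []) (sym (transpose-i j))
... | no _ | yes refl | true rewrite transpose-1+i i | σ-gᵢ i | σ⁻¹-gᵢ₊₁ i =
  cong₂ (λ k l → (k , false) ∷ (l , true) ∷ (k , true) ∷ []) (sym (transpose-i i)) (sym (transpose-1+i i))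
... | no _ | yes refl | false rewrite transpose-1+i i | σ-gᵢ i | σ⁻¹-gᵢ₊₁ i =
  cong₂ (λ k l → (k , false) ∷ (l , false) ∷ (k , true) ∷ []) (sym (transpose-i i)) (sym (transpose-1+i i))
... | no j≢i | no j≢1+i | true rewrite transpose-j i j j≢i j≢1+i | actGen-gⱼ i false j j≢i j≢1+i | actGen-gⱼ i true j j≢i j≢1+i =
  cong (λ k → (k , true) ∷ []) (sym (transpose-j i j j≢i j≢1+i))
... | no j≢i | no j≢1+i | false rewrite transpose-j i j j≢i j≢1+i | actGen-gⱼ i false j j≢i j≢1+i | actGen-gⱼ i true j j≢i j≢1+i =
  cong (λ k → (k , false) ∷ []) (sym (transpose-j i j j≢i j≢1+i))

module κ-Permutation (i : ℕ) = LetterPermutation (κ i) (λ _ → refl) (κ-injective i)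

σ⁻¹-conjugate : ∀ i w → act i false w ≡ map (κ i) (act i true (map (κ i) w))
σ⁻¹-conjugate i w = begin
  reduce (concatMap (actLetter i false) w)
    ≡⟨ cong reduce (concatMap-cong (κ-conjugates-σ i) w) ⟩
  reduce (concatMap (map (κ i) ∘ actLetter i true ∘ κ i) w)
    ≡⟨ cong reduce (map-concatMap (κ i) (actLetter i true ∘ κ i) w) ⟨
  reduce (map (κ i) (concatMap (actLetter i true ∘ κ i) w))
    ≡⟨ cong (reduce ∘ map (κ i)) (concatMap-map (actLetter i true) (κ i) w) ⟨
  reduce (map (κ i) (concatMap (actLetter i true) (map (κ i) w)))
    ≡⟨ κ-Permutation.reduce-map i (concatMap (actLetter i true) (map (κ i) w)) ⟩
  map (κ i) (act i true (map (κ i) w))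
    ∎
  where open ≡-Reasoning

-- σ-Image i w R: how the reduced image R of the reduced word w under σ_i begins.
data σ-Image (i : ℕ) : Word → Word → Set where
  []     : σ-Image i [] []
  gᵢ     : ∀ s w r → σ-Image i ((i , s) ∷ w) (g i ∷ (suc i , s) ∷ r)
  gᵢ₊₁   : ∀ w r → OnHead (λ y → proj₁ y ≢ suc i) r → σ-Image i (g (suc i) ∷ w) (g i ∷ r)
  gᵢ₊₁⁻¹ : ∀ w y r → y ≡ g⁻¹ i ⊎ proj₁ y ≡ suc i → σ-Image i (g⁻¹ (suc i) ∷ w) (y ∷ r)
  gⱼ     : ∀ j s w r → j ≢ i → j ≢ suc i → σ-Image i ((j , s) ∷ w) ((j , s) ∷ r)

module _ {i : ℕ} where

  keep : ∀ {w} x R → OnHead (_≢ invL x) R → σ-Image i w (x ∷ R) → σ-Image i w (push x R)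
  keep x R h = subst (σ-Image i _) (sym (push-keep x R h))

  cancel : ∀ {w} x R → σ-Image i w R → σ-Image i w (push x (invL x ∷ R))
  cancel x R = subst (σ-Image i _) (sym (push-cancel x R))

  ≢gᵢ : ∀ {y} → y ≡ g⁻¹ i ⊎ proj₁ y ≡ suc i → y ≢ g i
  ≢gᵢ (inj₁ refl) ()
  ≢gᵢ (inj₂ p) e = i≢1+i (trans (sym (cong proj₁ e)) p)

  gᵢ⁻¹-prepends : ∀ {s w R} → σ-Image i w R → IsReduced ((i , s) ∷ w) →
                  OnHead (_≢ (suc i , not s)) (push (g⁻¹ i) R)
  gᵢ⁻¹-prepends {s} = prepends
    where
    Avoids : Word → Set
    Avoids = OnHead (_≢ (suc i , not s))

    prepends : ∀ {w R} → σ-Image i w R → IsReduced ((i , s) ∷ w) → Avoids (push (g⁻¹ i) R)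
    prepends [] _ = ≢-index i≢1+i
    prepends (gᵢ s′ w r) (s′≢ , _) =
      subst Avoids (sym (push-cancel (g⁻¹ i) _)) (λ e → s′≢ (cong (i ,_) (cong proj₂ e)))
    prepends (gᵢ₊₁ w r nd) _ =
      subst Avoids (sym (push-cancel (g⁻¹ i) r)) (OnHead-map (λ ne → ne ∘ cong proj₁) r nd)
    prepends (gᵢ₊₁⁻¹ w y r y-ok) _ =
      subst Avoids (sym (push-keep (g⁻¹ i) (y ∷ r) (≢gᵢ y-ok))) (≢-index i≢1+i)
    prepends (gⱼ j s′ w r j≢i _) _ =
      subst Avoids (sym (push-keep (g⁻¹ i) ((j , s′) ∷ r) (≢-index j≢i))) (≢-index i≢1+i)

  step-gᵢ : ∀ {s w R} → σ-Image i w R → IsReduced ((i , s) ∷ w) →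
            σ-Image i ((i , s) ∷ w) (push (g i) (push (suc i , s) (push (g⁻¹ i) R)))
  step-gᵢ {s} {w} {R} img red = subst (σ-Image i _) (sym pushes) (gᵢ s w R′)
    where
    R′ = push (g⁻¹ i) R

    pushes : push (g i) (push (suc i , s) R′) ≡ g i ∷ (suc i , s) ∷ R′
    pushes = trans (cong (push (g i)) (push-keep (suc i , s) R′ (gᵢ⁻¹-prepends img red)))
                   (push-keep (g i) ((suc i , s) ∷ R′) (≢-index (i≢1+i ∘ sym)))

  step-gᵢ₊₁ : ∀ {w R} → σ-Image i w R → IsReduced (g (suc i) ∷ w) →
              σ-Image i (g (suc i) ∷ w) (push (g i) R)
  step-gᵢ₊₁ [] _ = gᵢ₊₁ [] [] tt
  step-gᵢ₊₁ (gᵢ s w r) _ = gᵢ₊₁ _ _ i≢1+i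
  step-gᵢ₊₁ (gᵢ₊₁ w r _) _ = gᵢ₊₁ _ _ i≢1+i
  step-gᵢ₊₁ (gᵢ₊₁⁻¹ w y r _) (≢inv , _) = ⊥-elim (≢inv refl)
  step-gᵢ₊₁ (gⱼ j s w r j≢i j≢1+i) _ = keep (g i) ((j , s) ∷ r) (≢-index j≢i) (gᵢ₊₁ _ _ j≢1+i)

  step-gᵢ₊₁⁻¹ : ∀ {w R} → σ-Image i w R → IsReduced (g⁻¹ (suc i) ∷ w) →
                σ-Image i (g⁻¹ (suc i) ∷ w) (push (g⁻¹ i) R)
  step-gᵢ₊₁⁻¹ [] _ = gᵢ₊₁⁻¹ [] _ [] (inj₁ refl)
  step-gᵢ₊₁⁻¹ (gᵢ s w r) _ = cancel (g⁻¹ i) ((suc i , s) ∷ r) (gᵢ₊₁⁻¹ _ _ r (inj₂ refl))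
  step-gᵢ₊₁⁻¹ (gᵢ₊₁ w r _) (≢inv , _) = ⊥-elim (≢inv refl)
  step-gᵢ₊₁⁻¹ (gᵢ₊₁⁻¹ w y r y-ok) _ = keep (g⁻¹ i) (y ∷ r) (≢gᵢ y-ok) (gᵢ₊₁⁻¹ _ _ _ (inj₁ refl))
  step-gᵢ₊₁⁻¹ (gⱼ j s w r j≢i _) _ = keep (g⁻¹ i) ((j , s) ∷ r) (≢-index j≢i) (gᵢ₊₁⁻¹ _ _ _ (inj₁ refl))

  step-gⱼ : ∀ {j s w R} → j ≢ i → j ≢ suc i → σ-Image i w R → IsReduced ((j , s) ∷ w) →
            σ-Image i ((j , s) ∷ w) (push (j , s) R)
  step-gⱼ j≢i j≢1+i [] _ = gⱼ _ _ [] [] j≢i j≢1+i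
  step-gⱼ {j} {s} {R = R} j≢i j≢1+i img red = keep (j , s) R (avoids img red) (gⱼ _ _ _ _ j≢i j≢1+i)
    where
    avoids : ∀ {w R} → σ-Image i w R → IsReduced ((j , s) ∷ w) → OnHead (_≢ (j , not s)) R
    avoids [] _ = tt
    avoids (gᵢ _ _ _) _ = ≢-index (j≢i ∘ sym)
    avoids (gᵢ₊₁ _ _ _) _ = ≢-index (j≢i ∘ sym)
    avoids (gᵢ₊₁⁻¹ _ _ _ (inj₁ refl)) _ = ≢-index (j≢i ∘ sym)
    avoids (gᵢ₊₁⁻¹ _ _ _ (inj₂ p)) _ = λ e → j≢1+i (trans (sym (cong proj₁ e)) p)
    avoids (gⱼ _ _ _ _ _ _) (≢inv , _) = ≢inv

  σ-step : ∀ {w R} x → σ-Image i w R → IsReduced (x ∷ w) →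
           σ-Image i (x ∷ w) (foldr push R (actLetter i true x))
  σ-step (j , s) img red with j ≟ i | j ≟ suc i | s
  ... | yes refl | _ | true rewrite σ-gᵢ j = step-gᵢ img red
  ... | yes refl | _ | false rewrite σ-gᵢ j = step-gᵢ img red
  ... | no _ | yes refl | true rewrite σ-gᵢ₊₁ i = step-gᵢ₊₁ img red
  ... | no _ | yes refl | false rewrite σ-gᵢ₊₁ i = step-gᵢ₊₁⁻¹ img red
  ... | no j≢i | no j≢1+i | true rewrite actGen-gⱼ i true j j≢i j≢1+i = step-gⱼ j≢i j≢1+i img red
  ... | no j≢i | no j≢1+i | false rewrite actGen-gⱼ i true j j≢i j≢1+i = step-gⱼ j≢i j≢1+i img red

σ-image : ∀ i w → IsReduced w → σ-Image i w (act i true w)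
σ-image i [] _ = []
σ-image i (x ∷ w) red =
  subst (σ-Image i (x ∷ w)) (sym (act-∷ i true x w)) (σ-step x (σ-image i w (reduced-tail x w red)) red)

σ-Image-gᵢ-head : ∀ {i s w R} → σ-Image i ((i , s) ∷ w) R → ∃ λ r → R ≡ g i ∷ r
σ-Image-gᵢ-head (gᵢ _ _ _) = _ , refl
σ-Image-gᵢ-head (gⱼ _ _ _ _ i≢i _) = ⊥-elim (i≢i refl)

σ-Image-gⱼ-head : ∀ {i j s w R} → j ≢ i → j ≢ suc i → σ-Image i ((j , s) ∷ w) R →
                  ∃ λ r → R ≡ (j , s) ∷ r
σ-Image-gⱼ-head j≢i _ (gᵢ _ _ _) = ⊥-elim (j≢i refl)
σ-Image-gⱼ-head _ j≢1+i (gᵢ₊₁ _ _ _) = ⊥-elim (j≢1+i refl)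
σ-Image-gⱼ-head _ j≢1+i (gᵢ₊₁⁻¹ _ _ _ _) = ⊥-elim (j≢1+i refl)
σ-Image-gⱼ-head _ _ (gⱼ _ _ _ _ _ _) = _ , refl

act-fixes-head : ∀ i b j s w → j ≢ i → j ≢ suc i → IsReduced ((j , s) ∷ w) →
                 ∃ λ r → act i b ((j , s) ∷ w) ≡ (j , s) ∷ r
act-fixes-head i true j s w j≢i j≢1+i red = σ-Image-gⱼ-head j≢i j≢1+i (σ-image i _ red)
act-fixes-head i false j s w j≢i j≢1+i red
  with σ-Image-gⱼ-head (subst (_≢ i) (sym fixed) j≢i) (subst (_≢ suc i) (sym fixed) j≢1+i)
         (σ-image i (map (κ i) ((j , s) ∷ w)) (κ-Permutation.map-reduced i _ red))
  where fixed = transpose-j i j j≢i j≢1+i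
... | r , image≡ = map (κ i) r , (begin
  act i false ((j , s) ∷ w)                    ≡⟨ σ⁻¹-conjugate i ((j , s) ∷ w) ⟩
  map (κ i) (act i true (map (κ i) ((j , s) ∷ w))) ≡⟨ cong (map (κ i)) image≡ ⟩
  κ i (κ i (j , s)) ∷ map (κ i) r              ≡⟨ cong (_∷ map (κ i) r) (κ-involutive i (j , s)) ⟩
  (j , s) ∷ map (κ i) r                        ∎)
  where open ≡-Reasoning

mainTheorem1 : (f : Word) → IsReduced f → BeginsWithG1 f →
    (i : ℕ) (b : Bool) → 1 ≤ i → ¬ (i ≡ 1 × b ≡ false) →
    BeginsWithG1 (act i b f)
mainTheorem1 .(g 1 ∷ w) red (w , refl) i b 1≤i not-σ₁⁻¹ with i ≟ 1 | b
... | no i≢1 | b′ = act-fixes-head i b′ 1 true w (i≢1 ∘ sym) (1≢1+i 1≤i) red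
  where
  1≢1+i : 1 ≤ i → 1 ≢ suc i
  1≢1+i (s≤s _) ()
... | yes refl | true = σ-Image-gᵢ-head (σ-image 1 _ red)
... | yes refl | false = ⊥-elim (not-σ₁⁻¹ (refl , refl))
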